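{- Let $\Gamma$ be an additive rational gain graph on vertex set $\{1,\dots,\ell\}$ with edges labelled $1,\dots,n$, with no loops, at most two parallel edges between any two vertices, and every circle of length $2$ unbalanced. Label the hyperplanes of $\mathcal{A}(\Gamma)$ by $\{0,1,\dots,n\}$, with $0$ labelling $\{x_0=0\}$. Let $S=\{i_1,i_2,i_3\}$ with $0\le i_1<i_2<i_3\le n$. Then $S$ is dependent if and only if either $i_1,i_2,i_3$ are the edges of a subgraph of $\langle\Gamma\rangle$ isomorphic to $K_3$, or $i_1=0$ and $i_2,i_3$ are the edges of a subgraph of $\langle\Gamma\rangle$ isomorphic to $D_2$.
   Context: A gain graph $\Gamma=(G,\varphi)$: finite graph $G$ with a gain map $\varphi$ assigning a rational number to each oriented edge with $\varphi(\mathtt e^{ -1})=-\varphi(\mathtt e)$. A circle is balanced if the sum of gains along it (in one direction) is $0$; $\langle\Gamma\rangle$ is $G$ together with its set of balanced circles; subgraphs of $\langle\Gamma\rangle$ carry the balanced circles of $\Gamma$ they contain, and isomorphism of biased graphs means a graph isomorphism matching balanced circles exactly. $K_3$ is the simple triangle whose circle is balanced; $D_2$ is two vertices joined by two parallel edges forming an unbalanced circle. $\mathcal{A}(\Gamma)$ is the arrangement in $\mathbb C^{\ell+1}$ (coordinates $x_0,\dots,x_\ell$) with hyperplanes $H_0=\{x_0=0\}$ and, for edge $\mathtt e$ oriented from $i$ to $j$, $\{x_i-x_j+\varphi(\mathtt e)x_0=0\}$. A set $S$ of hyperplane labels is dependent if the defining linear forms of the hyperplanes labelled by $S$ are linearly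 dependent. -}

module Defs where

open import Data.Nat using (ℕ; suc)
open import Data.Fin using (Fin; zero; suc; _≟_)
open import Data.Rational using (ℚ; 0ℚ; 1ℚ; _+_; _*_; -_; _-_)
open import Data.List using (List; []; _∷_; length; zipWith; foldr)
open import Data.List.Relation.Unary.Any using (Any)
open import Data.Product using (Σ; ∃; ∃-syntax; _×_; _,_)
open import Data.Sum using (_⊎_)
open import Relation.Binary.PropositionalEquality using (_≡_; _≢_)
open import Relation.Nullary using (¬_; yes; no)

-- Each edge e has a fixed
-- reference orientation tail e → head e, and gain e is φ of that
-- oriented edge; the reverse orientation has gain - gain e.
record GainGraph (ℓ n : ℕ) : Set where
  field
    tail : Fin n → Fin ℓ
    head : Fin n → Fin ℓ
    gain : Fin n → ℚ

sumℚ : List ℚ → ℚ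
sumℚ = foldr _+_ 0ℚ

module _ {ℓ n : ℕ} (Γ : GainGraph ℓ n) where
  open GainGraph Γ

  Joins : Fin n → Fin ℓ → Fin ℓ → Set
  Joins e u v = (tail e ≡ u × head e ≡ v) ⊎ (tail e ≡ v × head e ≡ u)

  -- gain of edge e traversed starting at vertex u
  -- (meaningful when u is an endpoint of e)
  gainFrom : Fin n → Fin ℓ → ℚ
  gainFrom e u with tail e ≟ u
  ... | yes _ = gain e
  ... | no _ = - gain e

  Parallel : Fin n → Fin n → Set
  Parallel e f = Joins f (tail e) (head e)

  NoLoops : Set
  NoLoops = ∀ e → tail e ≢ head e

  AtMostTwoParallel : Set
  AtMostTwoParallel = ∀ e f g → e ≢ f → e ≢ g → f ≢ g →
    ¬ (Parallel e f × Parallel e g)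

  TwoCircleGain : Fin n → Fin n → ℚ
  TwoCircleGain e f = gainFrom e (tail e) + gainFrom f (head e)

  TwoCirclesUnbalanced : Set
  TwoCirclesUnbalanced = ∀ e f → e ≢ f → Parallel e f → TwoCircleGain e f ≢ 0ℚ

  -- Subgraph of ⟨Γ⟩ with edge set {e₁,e₂,e₃} is isomorphic to K₃:
  -- a simple triangle on three distinct vertices a,b,c (e₁ = ab,
  -- e₂ = bc, e₃ = ca) whose circle is balanced.
  IsK3 : Fin n → Fin n → Fin n → Set
  IsK3 e₁ e₂ e₃ = ∃[ a ] ∃[ b ] ∃[ c ]
    (a ≢ b × b ≢ c × c ≢ a ×
     Joins e₁ a b × Joins e₂ b c × Joins e₃ c a ×
     gainFrom e₁ a + gainFrom e₂ b + gainFrom e₃ c ≡ 0ℚ)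

  -- Subgraph of ⟨Γ⟩ with edge set {e,f} is isomorphic to D₂:
  -- two distinct vertices a ≠ b joined by both e and f (e ≠ f),
  -- forming an unbalanced circle.
  IsD2 : Fin n → Fin n → Set
  IsD2 e f = ∃[ a ] ∃[ b ]
    (a ≢ b × e ≢ f × Joins e a b × Joins f a b ×
     gainFrom e a + gainFrom f b ≢ 0ℚ)

  -- Hyperplane labels: Fin (suc n); zero labels H₀ = {x₀ = 0},
  -- suc e labels {x_{tail e} - x_{head e} + gain e · x₀ = 0}.
  -- Coordinates of ℂ^{ℓ+1}: index zero is x₀, index suc v is x_v.
  -- The defining linear form, as its coefficient vector.
  δ : Fin ℓ → Fin ℓ → ℚ
  δ u v with u ≟ v
  ... | yes _ = 1ℚ
  ... | no _ = 0ℚ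

  form : Fin (suc n) → Fin (suc ℓ) → ℚ
  form zero zero = 1ℚ
  form zero (suc v) = 0ℚ
  form (suc e) zero = gain e
  form (suc e) (suc v) = δ (tail e) v - δ (head e) v

  Dependent : List (Fin (suc n)) → Set
  Dependent S = ∃[ cs ]
    (length cs ≡ length S × Any (λ c → c ≢ 0ℚ) cs ×
     (∀ k → sumℚ (zipWith (λ c i → c * form i k) cs S) ≡ 0ℚ))

  IsEdge : Fin (suc n) → Fin n → Set
  IsEdge i e = i ≡ suc e

-- Write the form of an edge traversed from a to b as ±(x_a − x_b + g·x₀), g the gain in that
-- direction.  In a vanishing combination of three edge forms a zero coefficient would leave two
-- dependent edge forms; their vertex coordinates force the edges to be parallel and the x₀
-- coordinate makes the 2-circle balanced, which is excluded.  So all coefficients are nonzero,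
-- every endpoint of each edge lies on another of the edges, and since no three edges are parallel
-- the edges form a triangle.  The vertex coordinates then make the oriented coefficients equal,
-- and the x₀ coordinate says the triangle is balanced.  With H₀ present, the vertex coordinates
-- alone force the two edges to be parallel, giving a D₂.  Conversely, the oriented forms around a
-- balanced triangle telescope to 0, and so do those around a digon once H₀ is added with
-- coefficient minus the gain of the 2-circle.
module Submission where

open import Defs
open import Data.Nat using (ℕ; suc; s<s⁻¹)
open import Data.Fin using (Fin; zero; suc; _<_) renaming (_≟_ to _≟ᶠ_)
open import Data.Fin.Properties using (<⇒≢; <-trans)
open import Data.List using ([]; _∷_)
open import Data.List.Relation.Unary.Any using (Any; here; there)
open import Data.Rational using (ℚ; 0ℚ; 1ℚ; _+_; _*_; -_; _-_; 1/_; NonZero; ≢-nonZero)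
open import Data.Rational.Properties
  using (_≟_; +-comm; +-identityʳ; *-assoc; *-identityˡ; *-identityʳ; *-zeroˡ; *-zeroʳ; *-inverseˡ; 1≢0;
         +-0-group)
open import Algebra.Properties.Group +-0-group using (x∙y⁻¹≈ε⇒x≈y)
open import Data.Rational.Solver using (module +-*-Solver)
open import Data.Product using (∃-syntax; _×_; _,_)
open import Data.Sum using (_⊎_; inj₁; inj₂; [_,_]′; swap) renaming (map to ⊎-map)
open import Data.Empty using (⊥-elim)
open import Function using (_∘_; id)
open import Relation.Nullary using (¬_; yes; no)
open import Relation.Nullary.Decidable using (_⊎-dec_; decidable-stable)
open import Relation.Binary.PropositionalEquality
open import Function.Bundles using (_⇔_; mk⇔)

open +-*-Solver
open ≡-Reasoning

*-zero-cancelˡ : ∀ {p q} → p ≢ 0ℚ → p * q ≡ 0ℚ → q ≡ 0ℚ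
*-zero-cancelˡ {p} {q} p≢0 pq≡0 = begin
  q                ≡⟨ sym (*-identityˡ q) ⟩
  1ℚ * q           ≡⟨ cong (_* q) (sym (*-inverseˡ p)) ⟩
  (1/ p) * p * q   ≡⟨ *-assoc (1/ p) p q ⟩
  (1/ p) * (p * q) ≡⟨ cong ((1/ p) *_) pq≡0 ⟩
  (1/ p) * 0ℚ      ≡⟨ *-zeroʳ (1/ p) ⟩
  0ℚ               ∎
  where
  instance
    p-nonZero : NonZero p
    p-nonZero = ≢-nonZero p≢0

*-≢0 : ∀ {p q} → p ≢ 0ℚ → q ≢ 0ℚ → p * q ≢ 0ℚ
*-≢0 p≢0 q≢0 = q≢0 ∘ *-zero-cancelˡ p≢0

*≢0⇒≢0ʳ : ∀ p {q} → p * q ≢ 0ℚ → q ≢ 0ℚ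
*≢0⇒≢0ʳ p pq≢0 refl = pq≢0 (*-zeroʳ p)

*≢0⇒≢0ˡ : ∀ {p} q → p * q ≢ 0ℚ → p ≢ 0ℚ
*≢0⇒≢0ˡ q pq≢0 refl = pq≢0 (*-zeroˡ q)

p-q≡0⇒p≡q : ∀ {p q} → p - q ≡ 0ℚ → p ≡ q
p-q≡0⇒p≡q = x∙y⁻¹≈ε⇒x≈y _ _

+≡0⇒≢0 : ∀ {x y} → x + y ≡ 0ℚ → x ≢ 0ℚ → y ≢ 0ℚ
+≡0⇒≢0 {x} x+y≡0 x≢0 refl = x≢0 (trans (sym (+-identityʳ x)) x+y≡0)

-- The three-term sums below have the shape that sumℚ (zipWith …) takes on a three-element list.
sum₃≡0⇒≢0 : ∀ {x y z} → x + (y + (z + 0ℚ)) ≡ 0ℚ → x ≢ 0ℚ → y ≢ 0ℚ ⊎ z ≢ 0ℚ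
sum₃≡0⇒≢0 {y = y} {z} sum≡0 x≢0 with y ≟ 0ℚ | z ≟ 0ℚ
... | no y≢0   | _        = inj₁ y≢0
... | yes _    | no z≢0   = inj₂ z≢0
... | yes refl | yes refl = ⊥-elim (+≡0⇒≢0 sum≡0 x≢0 refl)

sum₃-cong : ∀ {x₁ x₂ x₃ y₁ y₂ y₃} → x₁ ≡ y₁ → x₂ ≡ y₂ → x₃ ≡ y₃ →
            x₁ + (x₂ + (x₃ + 0ℚ)) ≡ y₁ + (y₂ + (y₃ + 0ℚ))
sum₃-cong refl refl refl = refl

sum₃-swap₁₂ : ∀ x y z → x + (y + (z + 0ℚ)) ≡ y + (x + (z + 0ℚ))
sum₃-swap₁₂ = solve 3 (λ x y z → x :+ (y :+ (z :+ con 0ℚ)) := y :+ (x :+ (z :+ con 0ℚ))) refl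

sum₃-swap₁₃ : ∀ x y z → x + (y + (z + 0ℚ)) ≡ z + (y + (x + 0ℚ))
sum₃-swap₁₃ = solve 3 (λ x y z → x :+ (y :+ (z :+ con 0ℚ)) := z :+ (y :+ (x :+ con 0ℚ))) refl

sum₃-drop₁ : ∀ {x} y z → x ≡ 0ℚ → x + (y + (z + 0ℚ)) ≡ y + z
sum₃-drop₁ y z refl = solve 2 (λ y z → con 0ℚ :+ (y :+ (z :+ con 0ℚ)) := y :+ z) refl y z

any₃⇒⊎ : ∀ {c₁ c₂ c₃} → Any (_≢ 0ℚ) (c₁ ∷ c₂ ∷ c₃ ∷ []) → c₁ ≢ 0ℚ ⊎ c₂ ≢ 0ℚ ⊎ c₃ ≢ 0ℚ
any₃⇒⊎ (here c₁≢0)                 = inj₁ c₁≢0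
any₃⇒⊎ (there (here c₂≢0))         = inj₂ (inj₁ c₂≢0)
any₃⇒⊎ (there (there (here c₃≢0))) = inj₂ (inj₂ c₃≢0)
any₃⇒⊎ (there (there (there ())))

module _ {ℓ n : ℕ} (Γ : GainGraph ℓ n) where
  open GainGraph Γ

  δ-self : ∀ u → δ Γ u u ≡ 1ℚ
  δ-self u with u ≟ᶠ u
  ... | yes _   = refl
  ... | no u≢u  = ⊥-elim (u≢u refl)

  δ-distinct : ∀ {u v} → u ≢ v → δ Γ u v ≡ 0ℚ
  δ-distinct {u} {v} u≢v with u ≟ᶠ v
  ... | yes u≡v = ⊥-elim (u≢v u≡v)
  ... | no _    = refl

  -- The linear form x_a − x_b + g·x₀ of an edge with gain g traversed from a to b;
  -- form Γ (suc e) is arc (tail e) (head e) (gain e).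
  arc : Fin ℓ → Fin ℓ → ℚ → Fin (suc ℓ) → ℚ
  arc a b g zero    = g
  arc a b g (suc v) = δ Γ a v - δ Γ b v

  arc-source : ∀ {a b} → a ≢ b → ∀ g → arc a b g (suc a) ≡ 1ℚ
  arc-source {a} a≢b g = cong₂ _-_ (δ-self a) (δ-distinct (a≢b ∘ sym))

  arc-target : ∀ {a b} → a ≢ b → ∀ g → arc a b g (suc b) ≡ - 1ℚ
  arc-target {b = b} a≢b g = cong₂ _-_ (δ-distinct a≢b) (δ-self b)

  arc-away : ∀ {a b v} → a ≢ v → b ≢ v → ∀ g → arc a b g (suc v) ≡ 0ℚ
  arc-away a≢v b≢v g = cong₂ _-_ (δ-distinct a≢v) (δ-distinct b≢v)

  digon-balanced : ∀ {a b d₁ d₂ g₁ g₂} → a ≢ b →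
    (∀ k → d₁ * arc a b g₁ k + d₂ * arc b a g₂ k ≡ 0ℚ) → d₁ ≢ 0ℚ ⊎ d₂ ≢ 0ℚ →
    g₁ + g₂ ≡ 0ℚ
  digon-balanced {a} {b} {d₁} {d₂} {g₁} {g₂} a≢b vanishes nonzero =
    *-zero-cancelˡ d₁≢0 (begin
      d₁ * (g₁ + g₂)     ≡⟨ solve 3 (λ d g₁ g₂ → d :* (g₁ :+ g₂) := d :* g₁ :+ d :* g₂) refl d₁ g₁ g₂ ⟩
      d₁ * g₁ + d₁ * g₂  ≡⟨ cong (λ d → d₁ * g₁ + d * g₂) d₁≡d₂ ⟩
      d₁ * g₁ + d₂ * g₂  ≡⟨ vanishes zero ⟩
      0ℚ                 ∎)
    where
    d₁≡d₂ : d₁ ≡ d₂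
    d₁≡d₂ = p-q≡0⇒p≡q (begin
      d₁ - d₂
        ≡⟨ solve 2 (λ d₁ d₂ → d₁ :- d₂ := d₁ :* con 1ℚ :+ d₂ :* con (- 1ℚ)) refl d₁ d₂ ⟩
      d₁ * 1ℚ + d₂ * - 1ℚ
        ≡⟨ cong₂ (λ x y → d₁ * x + d₂ * y) (arc-source a≢b g₁) (arc-target (a≢b ∘ sym) g₂) ⟨
      d₁ * arc a b g₁ (suc a) + d₂ * arc b a g₂ (suc a)
        ≡⟨ vanishes (suc a) ⟩
      0ℚ ∎)
    d₁≢0 : d₁ ≢ 0ℚ
    d₁≢0 = [ id , subst (_≢ 0ℚ) (sym d₁≡d₂) ]′ nonzero

  triangle-balanced : ∀ {a b c d₁ d₂ d₃ g₁ g₂ g₃} → a ≢ b → b ≢ c → c ≢ a → d₁ ≢ 0ℚ →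
    (∀ k → d₁ * arc a b g₁ k + (d₂ * arc b c g₂ k + (d₃ * arc c a g₃ k + 0ℚ)) ≡ 0ℚ) →
    g₁ + g₂ + g₃ ≡ 0ℚ
  triangle-balanced {a} {b} {c} {d₁} {d₂} {d₃} {g₁} {g₂} {g₃} a≢b b≢c c≢a d₁≢0 vanishes =
    *-zero-cancelˡ d₁≢0 (begin
      d₁ * (g₁ + g₂ + g₃)
        ≡⟨ solve 4 (λ d g₁ g₂ g₃ → d :* (g₁ :+ g₂ :+ g₃) := d :* g₁ :+ (d :* g₂ :+ (d :* g₃ :+ con 0ℚ)))
                   refl d₁ g₁ g₂ g₃ ⟩
      d₁ * g₁ + (d₁ * g₂ + (d₁ * g₃ + 0ℚ))
        ≡⟨ cong₂ (λ x y → d₁ * g₁ + (x * g₂ + (y * g₃ + 0ℚ))) d₁≡d₂ d₁≡d₃ ⟩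
      d₁ * g₁ + (d₂ * g₂ + (d₃ * g₃ + 0ℚ))
        ≡⟨ vanishes zero ⟩
      0ℚ ∎)
    where
    d₁≡d₃ : d₁ ≡ d₃
    d₁≡d₃ = p-q≡0⇒p≡q (begin
      d₁ - d₃
        ≡⟨ solve 3 (λ d₁ d₂ d₃ → d₁ :- d₃
                                 := d₁ :* con 1ℚ :+ (d₂ :* con 0ℚ :+ (d₃ :* con (- 1ℚ) :+ con 0ℚ)))
                   refl d₁ d₂ d₃ ⟩
      d₁ * 1ℚ + (d₂ * 0ℚ + (d₃ * - 1ℚ + 0ℚ))
        ≡⟨ sum₃-cong (cong (d₁ *_) (arc-source a≢b g₁)) (cong (d₂ *_) (arc-away (a≢b ∘ sym) c≢a g₂))
                     (cong (d₃ *_) (arc-target c≢a g₃)) ⟨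
      d₁ * arc a b g₁ (suc a) + (d₂ * arc b c g₂ (suc a) + (d₃ * arc c a g₃ (suc a) + 0ℚ))
        ≡⟨ vanishes (suc a) ⟩
      0ℚ ∎)
    d₁≡d₂ : d₁ ≡ d₂
    d₁≡d₂ = sym (p-q≡0⇒p≡q (begin
      d₂ - d₁
        ≡⟨ solve 3 (λ d₁ d₂ d₃ → d₂ :- d₁
                                 := d₁ :* con (- 1ℚ) :+ (d₂ :* con 1ℚ :+ (d₃ :* con 0ℚ :+ con 0ℚ)))
                   refl d₁ d₂ d₃ ⟩
      d₁ * - 1ℚ + (d₂ * 1ℚ + (d₃ * 0ℚ + 0ℚ))
        ≡⟨ sum₃-cong (cong (d₁ *_) (arc-target a≢b g₁)) (cong (d₂ *_) (arc-source b≢c g₂))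
                     (cong (d₃ *_) (arc-away (b≢c ∘ sym) a≢b g₃)) ⟨
      d₁ * arc a b g₁ (suc b) + (d₂ * arc b c g₂ (suc b) + (d₃ * arc c a g₃ (suc b) + 0ℚ))
        ≡⟨ vanishes (suc b) ⟩
      0ℚ ∎))

  orientation : Fin n → Fin ℓ → ℚ
  orientation e a with tail e ≟ᶠ a
  ... | yes _ = 1ℚ
  ... | no _  = - 1ℚ

  orientation≢0 : ∀ e a → orientation e a ≢ 0ℚ
  orientation≢0 e a with tail e ≟ᶠ a
  ... | yes _ = λ ()
  ... | no _  = λ ()

  orientation²≡1 : ∀ e a → orientation e a * orientation e a ≡ 1ℚ
  orientation²≡1 e a with tail e ≟ᶠ a
  ... | yes _ = refl
  ... | no _  = refl

  orientation-tail : ∀ e → orientation e (tail e) ≡ 1ℚ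
  orientation-tail e with tail e ≟ᶠ tail e
  ... | yes _ = refl
  ... | no t≢t = ⊥-elim (t≢t refl)

  orientation-head : ∀ e → tail e ≢ head e → orientation e (head e) ≡ - 1ℚ
  orientation-head e t≢h with tail e ≟ᶠ head e
  ... | yes t≡h = ⊥-elim (t≢h t≡h)
  ... | no _    = refl

  gainFrom≡orientation*gain : ∀ e a → gainFrom Γ e a ≡ orientation e a * gain e
  gainFrom≡orientation*gain e a with tail e ≟ᶠ a
  ... | yes _ = sym (*-identityˡ (gain e))
  ... | no _  = solve 1 (λ g → :- g := con (- 1ℚ) :* g) refl (gain e)

  Incident : Fin n → Fin ℓ → Set
  Incident e v = tail e ≡ v ⊎ head e ≡ v

  joins-sym : ∀ {e a b} → Joins Γ e a b → Joins Γ e b a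
  joins-sym = swap

  joins-incidentˡ : ∀ {e a b} → Joins Γ e a b → Incident e a
  joins-incidentˡ (inj₁ (t≡a , _)) = inj₁ t≡a
  joins-incidentˡ (inj₂ (_ , h≡a)) = inj₂ h≡a

  joins-incidentʳ : ∀ {e a b} → Joins Γ e a b → Incident e b
  joins-incidentʳ = joins-incidentˡ ∘ joins-sym

  incident-joins : ∀ {e a b v} → Joins Γ e a b → Incident e v → v ≡ a ⊎ v ≡ b
  incident-joins (inj₁ (refl , refl)) = ⊎-map sym sym
  incident-joins (inj₂ (refl , refl)) = swap ∘ ⊎-map sym sym

  incident⇒joins-other : ∀ {e a} → Incident e a → ∃[ b ] Joins Γ e a b
  incident⇒joins-other {e} (inj₁ t≡a) = head e , inj₁ (t≡a , refl)
  incident⇒joins-other {e} (inj₂ h≡a) = tail e , inj₂ (refl , h≡a)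

  incident⇒joins : ∀ {e a b} → Incident e a → Incident e b → a ≢ b → Joins Γ e a b
  incident⇒joins (inj₁ refl) (inj₁ refl) a≢b = ⊥-elim (a≢b refl)
  incident⇒joins (inj₁ t≡a)  (inj₂ h≡b)  _   = inj₁ (t≡a , h≡b)
  incident⇒joins (inj₂ h≡a)  (inj₁ t≡b)  _   = inj₂ (t≡b , h≡a)
  incident⇒joins (inj₂ refl) (inj₂ refl) a≢b = ⊥-elim (a≢b refl)

  parallel-sym : ∀ {e f} → Parallel Γ e f → Parallel Γ f e
  parallel-sym (inj₁ (t≡t , h≡h)) = inj₁ (sym t≡t , sym h≡h)
  parallel-sym (inj₂ (t≡h , h≡t)) = inj₂ (sym h≡t , sym t≡h)

  CoveredBy : Fin n → Fin n → Fin n → Set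
  CoveredBy e f g = ∀ v → Incident e v → Incident f v ⊎ Incident g v

  Triangle : Fin n → Fin n → Fin n → Set
  Triangle e₁ e₂ e₃ = ∃[ a ] ∃[ b ] ∃[ c ] (Joins Γ e₁ a b × Joins Γ e₂ b c × Joins Γ e₃ c a)

  -- Records rather than synonyms, so that coefficients and labels can be inferred.
  record Vanishes₂ (c₁ c₂ : ℚ) (i₁ i₂ : Fin (suc n)) : Set where
    constructor vanishing₂
    field at : ∀ k → c₁ * form Γ i₁ k + c₂ * form Γ i₂ k ≡ 0ℚ

  record Vanishes₃ (c₁ c₂ c₃ : ℚ) (i₁ i₂ i₃ : Fin (suc n)) : Set where
    constructor vanishing₃
    field at : ∀ k → c₁ * form Γ i₁ k + (c₂ * form Γ i₂ k + (c₃ * form Γ i₃ k + 0ℚ)) ≡ 0ℚ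

  open Vanishes₂
  open Vanishes₃

  vanishes₃-swap₁₂ : ∀ {c₁ c₂ c₃ i₁ i₂ i₃} → Vanishes₃ c₁ c₂ c₃ i₁ i₂ i₃ → Vanishes₃ c₂ c₁ c₃ i₂ i₁ i₃
  vanishes₃-swap₁₂ {c₁} {c₂} {c₃} {i₁} {i₂} {i₃} vanishes = vanishing₃ λ k →
    trans (sum₃-swap₁₂ (c₂ * form Γ i₂ k) (c₁ * form Γ i₁ k) (c₃ * form Γ i₃ k)) (at vanishes k)

  vanishes₃-swap₁₃ : ∀ {c₁ c₂ c₃ i₁ i₂ i₃} → Vanishes₃ c₁ c₂ c₃ i₁ i₂ i₃ → Vanishes₃ c₃ c₂ c₁ i₃ i₂ i₁
  vanishes₃-swap₁₃ {c₁} {c₂} {c₃} {i₁} {i₂} {i₃} vanishes = vanishing₃ λ k →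
    trans (sum₃-swap₁₃ (c₃ * form Γ i₃ k) (c₂ * form Γ i₂ k) (c₁ * form Γ i₁ k)) (at vanishes k)

  vanishes₃-drop₁ : ∀ {c₂ c₃ i₁ i₂ i₃} → Vanishes₃ 0ℚ c₂ c₃ i₁ i₂ i₃ → Vanishes₂ c₂ c₃ i₂ i₃
  vanishes₃-drop₁ {c₂} {c₃} {i₁} {i₂} {i₃} vanishes = vanishing₂ λ k →
    trans (sym (sum₃-drop₁ (c₂ * form Γ i₂ k) (c₃ * form Γ i₃ k) (*-zeroˡ (form Γ i₁ k))))
          (at vanishes k)

  triangle-arcs-cancel : ∀ {a b c g₁ g₂ g₃} → g₁ + g₂ + g₃ ≡ 0ℚ →
    ∀ k → arc a b g₁ k + (arc b c g₂ k + (arc c a g₃ k + 0ℚ)) ≡ 0ℚ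
  triangle-arcs-cancel {g₁ = g₁} {g₂} {g₃} balanced zero =
    trans (solve 3 (λ x y z → x :+ (y :+ (z :+ con 0ℚ)) := x :+ y :+ z) refl g₁ g₂ g₃) balanced
  triangle-arcs-cancel {a} {b} {c} _ (suc v) =
    solve 3 (λ x y z → (x :- y) :+ ((y :- z) :+ ((z :- x) :+ con 0ℚ)) := con 0ℚ) refl
            (δ Γ a v) (δ Γ b v) (δ Γ c v)

  digon-arcs-cancel : ∀ a b g₁ g₂ k →
    - (g₁ + g₂) * form Γ zero k + (arc a b g₁ k + (arc b a g₂ k + 0ℚ)) ≡ 0ℚ
  digon-arcs-cancel _ _ g₁ g₂ zero =
    solve 2 (λ x y → :- (x :+ y) :* con 1ℚ :+ (x :+ (y :+ con 0ℚ)) := con 0ℚ) refl g₁ g₂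
  digon-arcs-cancel a b g₁ g₂ (suc v) =
    solve 3 (λ c x y → c :* con 0ℚ :+ ((x :- y) :+ ((y :- x) :+ con 0ℚ)) := con 0ℚ) refl
            (- (g₁ + g₂)) (δ Γ a v) (δ Γ b v)

  K3OrD2 : Fin (suc n) → Fin (suc n) → Fin (suc n) → Set
  K3OrD2 i₁ i₂ i₃ =
    (∃[ e₁ ] ∃[ e₂ ] ∃[ e₃ ] (i₁ ≡ suc e₁ × i₂ ≡ suc e₂ × i₃ ≡ suc e₃ × IsK3 Γ e₁ e₂ e₃))
    ⊎ (i₁ ≡ zero × ∃[ e₂ ] ∃[ e₃ ] (i₂ ≡ suc e₂ × i₃ ≡ suc e₃ × IsD2 Γ e₂ e₃))

  module _ (noLoops : NoLoops Γ) where

    joins⇒≢ : ∀ {e a b} → Joins Γ e a b → a ≢ b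
    joins⇒≢ {e} (inj₁ (refl , refl)) = noLoops e
    joins⇒≢ {e} (inj₂ (refl , refl)) = noLoops e ∘ sym

    oriented-form : ∀ {e a b} → Joins Γ e a b → ∀ k →
      orientation e a * form Γ (suc e) k ≡ arc a b (gainFrom Γ e a) k
    oriented-form {e} {a} _ zero = sym (gainFrom≡orientation*gain e a)
    oriented-form {e} (inj₁ (refl , refl)) (suc v) rewrite orientation-tail e = *-identityˡ _
    oriented-form {e} (inj₂ (refl , refl)) (suc v) rewrite orientation-head e (noLoops e) =
      solve 2 (λ x y → con (- 1ℚ) :* (x :- y) := y :- x) refl (δ Γ (tail e) v) (δ Γ (head e) v)

    scaled-form : ∀ {e a b} → Joins Γ e a b → ∀ c k →
      c * form Γ (suc e) k ≡ (c * orientation e a) * arc a b (gainFrom Γ e a) k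
    scaled-form {e} {a} J c k = begin
      c * x              ≡⟨ cong (_* x) (sym (*-identityʳ c)) ⟩
      c * 1ℚ * x         ≡⟨ cong (λ t → c * t * x) (sym (orientation²≡1 e a)) ⟩
      c * (o * o) * x    ≡⟨ solve 3 (λ c o x → c :* (o :* o) :* x := (c :* o) :* (o :* x)) refl c o x ⟩
      (c * o) * (o * x)  ≡⟨ cong ((c * o) *_) (oriented-form J k) ⟩
      (c * o) * arc _ _ (gainFrom Γ e a) k ∎
      where
      x o : ℚ
      x = form Γ (suc e) k
      o = orientation e a

    incident⇒incidence≢0 : ∀ {e v} → Incident e v → form Γ (suc e) (suc v) ≢ 0ℚ
    incident⇒incidence≢0 {e} (inj₁ refl) eq = 1≢0 (trans (sym (arc-source (noLoops e) (gain e))) eq)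
    incident⇒incidence≢0 {e} (inj₂ refl) eq with trans (sym (arc-target (noLoops e) (gain e))) eq
    ... | ()

    incidence≢0⇒incident : ∀ {e v} → form Γ (suc e) (suc v) ≢ 0ℚ → Incident e v
    incidence≢0⇒incident {e} {v} incidence≢0 = decidable-stable (tail e ≟ᶠ v ⊎-dec head e ≟ᶠ v)
      (λ ¬incident → incidence≢0 (arc-away (¬incident ∘ inj₁) (¬incident ∘ inj₂) (gain e)))

    joins-within : ∀ {e a b g} → Joins Γ e a b → (∀ v → Incident g v → v ≡ a ⊎ v ≡ b) → Joins Γ g a b
    joins-within {g = g} J within with within (tail g) (inj₁ refl) | within (head g) (inj₂ refl)
    ... | inj₁ t≡a | inj₂ h≡b = inj₁ (t≡a , h≡b)
    ... | inj₂ t≡b | inj₁ h≡a = inj₂ (t≡b , h≡a)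
    ... | inj₁ t≡a | inj₁ h≡a = ⊥-elim (noLoops g (trans t≡a (sym h≡a)))
    ... | inj₂ t≡b | inj₂ h≡b = ⊥-elim (noLoops g (trans t≡b (sym h≡b)))

    covered-pair-not-parallel : AtMostTwoParallel Γ → ∀ {e f g} → e ≢ f → e ≢ g → f ≢ g →
      CoveredBy g e f → ¬ Parallel Γ e f
    covered-pair-not-parallel atMostTwo {e} e≢f e≢g f≢g covered e∥f =
      atMostTwo _ _ _ e≢f e≢g f≢g
        (e∥f , joins-within Jₑ (λ v → [ incident-joins Jₑ , incident-joins e∥f ]′ ∘ covered v))
      where
      Jₑ : Joins Γ e (tail e) (head e)
      Jₑ = inj₁ (refl , refl)

    close-triangle : ∀ {e₁ e₂ e₃ a b c} → Joins Γ e₁ a b → Joins Γ e₂ b c → c ≢ a →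
      CoveredBy e₁ e₂ e₃ → CoveredBy e₂ e₁ e₃ → Joins Γ e₃ c a
    close-triangle {e₁} {e₂} {e₃} {a} {c = c} J₁ J₂ c≢a covered₁ covered₂ = incident⇒joins c∈e₃ a∈e₃ c≢a
      where
      a∉e₂ : ¬ Incident e₂ a
      a∉e₂ = [ joins⇒≢ J₁ , c≢a ∘ sym ]′ ∘ incident-joins J₂
      c∉e₁ : ¬ Incident e₁ c
      c∉e₁ = [ c≢a , joins⇒≢ J₂ ∘ sym ]′ ∘ incident-joins J₁
      a∈e₃ : Incident e₃ a
      a∈e₃ = [ ⊥-elim ∘ a∉e₂ , id ]′ (covered₁ a (joins-incidentˡ J₁))
      c∈e₃ : Incident e₃ c
      c∈e₃ = [ ⊥-elim ∘ c∉e₁ , id ]′ (covered₂ c (joins-incidentʳ J₂))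

    continue-from-head : ∀ {e f} → ¬ Parallel Γ e f → Incident f (head e) →
      ∃[ c ] (c ≢ tail e × Joins Γ f (head e) c)
    continue-from-head e∦f h∈f with incident⇒joins-other h∈f
    ... | c , J = c , (λ { refl → e∦f (joins-sym J) }) , J

    covered⇒triangle : ∀ {e₁ e₂ e₃} → ¬ Parallel Γ e₁ e₂ → ¬ Parallel Γ e₁ e₃ →
      CoveredBy e₁ e₂ e₃ → CoveredBy e₂ e₁ e₃ → CoveredBy e₃ e₁ e₂ → Triangle e₁ e₂ e₃
    covered⇒triangle {e₁} {e₂} {e₃} e₁∦e₂ e₁∦e₃ covered₁ covered₂ covered₃ =
      [ through-e₂ ∘ continue-from-head e₁∦e₂ , through-e₃ ∘ continue-from-head e₁∦e₃ ]′
        (covered₁ (head e₁) (inj₂ refl))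
      where
      J₁ : Joins Γ e₁ (tail e₁) (head e₁)
      J₁ = inj₁ (refl , refl)
      through-e₂ : ∃[ c ] (c ≢ tail e₁ × Joins Γ e₂ (head e₁) c) → Triangle e₁ e₂ e₃
      through-e₂ (c , c≢a , J₂) =
        tail e₁ , head e₁ , c , J₁ , J₂ , close-triangle J₁ J₂ c≢a covered₁ covered₂
      through-e₃ : ∃[ c ] (c ≢ tail e₁ × Joins Γ e₃ (head e₁) c) → Triangle e₁ e₂ e₃
      through-e₃ (c , c≢a , J₃) =
        head e₁ , tail e₁ , c , joins-sym J₁ ,
        joins-sym (close-triangle J₁ J₃ c≢a (λ v → swap ∘ covered₁ v) covered₃) , joins-sym J₃

    vanishing⇒coveredBy : ∀ {c₁ c₂ c₃ e₁ e₂ e₃} → c₁ ≢ 0ℚ →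
      Vanishes₃ c₁ c₂ c₃ (suc e₁) (suc e₂) (suc e₃) → CoveredBy e₁ e₂ e₃
    vanishing⇒coveredBy {c₂ = c₂} {c₃} c₁≢0 vanishes v v∈e₁ =
      ⊎-map (incidence≢0⇒incident ∘ *≢0⇒≢0ʳ c₂) (incidence≢0⇒incident ∘ *≢0⇒≢0ʳ c₃)
        (sum₃≡0⇒≢0 (at vanishes (suc v)) (*-≢0 c₁≢0 (incident⇒incidence≢0 v∈e₁)))

    vanishing-incidences⇒parallel : ∀ {c d e f} →
      (∀ v → c * form Γ (suc e) (suc v) + d * form Γ (suc f) (suc v) ≡ 0ℚ) →
      c ≢ 0ℚ ⊎ d ≢ 0ℚ → Parallel Γ e f
    vanishing-incidences⇒parallel {c} {d} {e} {f} vanishes (inj₁ c≢0) =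
      incident⇒joins (shared (inj₁ refl)) (shared (inj₂ refl)) (noLoops e)
      where
      shared : ∀ {v} → Incident e v → Incident f v
      shared {v} v∈e = incidence≢0⇒incident
        (*≢0⇒≢0ʳ d (+≡0⇒≢0 (vanishes v) (*-≢0 c≢0 (incident⇒incidence≢0 v∈e))))
    vanishing-incidences⇒parallel {c} {d} {e} {f} vanishes (inj₂ d≢0) =
      parallel-sym (vanishing-incidences⇒parallel {d} {c} {f} {e}
        (λ v → trans (+-comm (d * form Γ (suc f) (suc v)) (c * form Γ (suc e) (suc v))) (vanishes v))
        (inj₁ d≢0))

    vanishing-triangle⇒K3 : ∀ {c₁ c₂ c₃ e₁ e₂ e₃} → c₁ ≢ 0ℚ →
      Vanishes₃ c₁ c₂ c₃ (suc e₁) (suc e₂) (suc e₃) → Triangle e₁ e₂ e₃ → IsK3 Γ e₁ e₂ e₃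
    vanishing-triangle⇒K3 {c₁} {c₂} {c₃} {e₁} {e₂} {e₃} c₁≢0 vanishes (a , b , c , J₁ , J₂ , J₃) =
      a , b , c , joins⇒≢ J₁ , joins⇒≢ J₂ , joins⇒≢ J₃ , J₁ , J₂ , J₃ ,
      triangle-balanced {d₂ = c₂ * orientation e₂ b} {d₃ = c₃ * orientation e₃ c}
        (joins⇒≢ J₁) (joins⇒≢ J₂) (joins⇒≢ J₃) (*-≢0 c₁≢0 (orientation≢0 e₁ a))
        (λ k → trans (sym (sum₃-cong (scaled-form J₁ c₁ k) (scaled-form J₂ c₂ k) (scaled-form J₃ c₃ k)))
                     (at vanishes k))

    nonzero-vanishing⇒K3 : AtMostTwoParallel Γ → ∀ {c₁ c₂ c₃ e₁ e₂ e₃} →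
      e₁ ≢ e₂ → e₁ ≢ e₃ → e₂ ≢ e₃ → c₁ ≢ 0ℚ → c₂ ≢ 0ℚ → c₃ ≢ 0ℚ →
      Vanishes₃ c₁ c₂ c₃ (suc e₁) (suc e₂) (suc e₃) → IsK3 Γ e₁ e₂ e₃
    nonzero-vanishing⇒K3 atMostTwo {e₁ = e₁} {e₂} {e₃} e₁≢e₂ e₁≢e₃ e₂≢e₃ c₁≢0 c₂≢0 c₃≢0 vanishes =
      vanishing-triangle⇒K3 c₁≢0 vanishes (covered⇒triangle e₁∦e₂ e₁∦e₃ covered₁ covered₂ covered₃)
      where
      covered₁ : CoveredBy e₁ e₂ e₃
      covered₁ = vanishing⇒coveredBy c₁≢0 vanishes
      covered₂ : CoveredBy e₂ e₁ e₃
      covered₂ = vanishing⇒coveredBy c₂≢0 (vanishes₃-swap₁₂ vanishes)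
      covered₃ : CoveredBy e₃ e₁ e₂
      covered₃ v = swap ∘ vanishing⇒coveredBy c₃≢0 (vanishes₃-swap₁₃ vanishes) v
      e₁∦e₂ : ¬ Parallel Γ e₁ e₂
      e₁∦e₂ = covered-pair-not-parallel atMostTwo e₁≢e₂ e₁≢e₃ e₂≢e₃ covered₃
      e₁∦e₃ : ¬ Parallel Γ e₁ e₃
      e₁∦e₃ = covered-pair-not-parallel atMostTwo e₁≢e₃ e₁≢e₂ (e₂≢e₃ ∘ sym) covered₂

    K3⇒dependent : ∀ {e₁ e₂ e₃} → IsK3 Γ e₁ e₂ e₃ → Dependent Γ (suc e₁ ∷ suc e₂ ∷ suc e₃ ∷ [])
    K3⇒dependent {e₁} {e₂} {e₃} (a , b , c , _ , _ , _ , J₁ , J₂ , J₃ , balanced) =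
      orientation e₁ a ∷ orientation e₂ b ∷ orientation e₃ c ∷ [] , refl , here (orientation≢0 e₁ a) ,
      λ k → trans (sum₃-cong (oriented-form J₁ k) (oriented-form J₂ k) (oriented-form J₃ k))
                  (triangle-arcs-cancel balanced k)

    D2⇒dependent : ∀ {e f} → IsD2 Γ e f → Dependent Γ (zero ∷ suc e ∷ suc f ∷ [])
    D2⇒dependent {e} {f} (a , b , _ , _ , Jₑ , J_f , _) =
      c₀ ∷ orientation e a ∷ orientation f b ∷ [] , refl , there (here (orientation≢0 e a)) ,
      λ k → trans (sum₃-cong (refl {x = c₀ * form Γ zero k}) (oriented-form Jₑ k)
                             (oriented-form (joins-sym J_f) k))
                  (digon-arcs-cancel a b (gainFrom Γ e a) (gainFrom Γ f b) k)
      where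
      c₀ : ℚ
      c₀ = - (gainFrom Γ e a + gainFrom Γ f b)

    K3OrD2⇒dependent : ∀ {i₁ i₂ i₃} → K3OrD2 i₁ i₂ i₃ → Dependent Γ (i₁ ∷ i₂ ∷ i₃ ∷ [])
    K3OrD2⇒dependent (inj₁ (_ , _ , _ , refl , refl , refl , k3)) = K3⇒dependent k3
    K3OrD2⇒dependent (inj₂ (refl , _ , _ , refl , refl , d2))    = D2⇒dependent d2

    module _ (unbalanced : TwoCirclesUnbalanced Γ) where

      edge-pair-independent : ∀ {c d e f} → e ≢ f → Vanishes₂ c d (suc e) (suc f) → ¬ (c ≢ 0ℚ ⊎ d ≢ 0ℚ)
      edge-pair-independent {c} {d} {e} {f} e≢f vanishes nonzero =
        unbalanced e f e≢f e∥f (digon-balanced (noLoops e) arcs-vanish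
          (⊎-map (λ c≢0 → *-≢0 c≢0 (orientation≢0 e (tail e)))
                 (λ d≢0 → *-≢0 d≢0 (orientation≢0 f (head e))) nonzero))
        where
        e∥f : Parallel Γ e f
        e∥f = vanishing-incidences⇒parallel {e = e} {f} (λ v → at vanishes (suc v)) nonzero
        arcs-vanish : ∀ k →
          c * orientation e (tail e) * arc (tail e) (head e) (gainFrom Γ e (tail e)) k
          + d * orientation f (head e) * arc (head e) (tail e) (gainFrom Γ f (head e)) k ≡ 0ℚ
        arcs-vanish k =
          trans (sym (cong₂ _+_ (scaled-form (inj₁ (refl , refl)) c k)
                                (scaled-form (joins-sym e∥f) d k)))
                (at vanishes k)

      dependent-H₀-edges⇒D2 : ∀ {c₀ c₁ c₂ e f} → e ≢ f → Vanishes₃ c₀ c₁ c₂ zero (suc e) (suc f) →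
        c₀ ≢ 0ℚ ⊎ c₁ ≢ 0ℚ ⊎ c₂ ≢ 0ℚ → IsD2 Γ e f
      dependent-H₀-edges⇒D2 {c₀} {c₁} {c₂} {e} {f} e≢f vanishes nonzero =
        tail e , head e , noLoops e , e≢f , inj₁ (refl , refl) , e∥f , unbalanced e f e≢f e∥f
        where
        edge-coefficient≢0 : c₁ ≢ 0ℚ ⊎ c₂ ≢ 0ℚ
        edge-coefficient≢0 = [ (λ c₀≢0 → ⊎-map (*≢0⇒≢0ˡ (gain e)) (*≢0⇒≢0ˡ (gain f))
                                               (sum₃≡0⇒≢0 (at vanishes zero) (*-≢0 c₀≢0 1≢0)))
                             , id ]′ nonzero
        e∥f : Parallel Γ e f
        e∥f = vanishing-incidences⇒parallel {e = e} {f}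
          (λ v → trans (sym (sum₃-drop₁ (c₁ * form Γ (suc e) (suc v)) (c₂ * form Γ (suc f) (suc v))
                                        (*-zeroʳ c₀)))
                       (at vanishes (suc v)))
          edge-coefficient≢0

      dependent-edges⇒K3 : AtMostTwoParallel Γ → ∀ {c₁ c₂ c₃ e₁ e₂ e₃} → e₁ ≢ e₂ → e₁ ≢ e₃ → e₂ ≢ e₃ →
        Vanishes₃ c₁ c₂ c₃ (suc e₁) (suc e₂) (suc e₃) → c₁ ≢ 0ℚ ⊎ c₂ ≢ 0ℚ ⊎ c₃ ≢ 0ℚ → IsK3 Γ e₁ e₂ e₃
      dependent-edges⇒K3 atMostTwo {c₁} {c₂} {c₃} e₁≢e₂ e₁≢e₃ e₂≢e₃ vanishes nonzero
        with c₁ ≟ 0ℚ | c₂ ≟ 0ℚ | c₃ ≟ 0ℚ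
      ... | yes refl | _        | _        = ⊥-elim (edge-pair-independent e₂≢e₃
        (vanishes₃-drop₁ vanishes) ([ (λ 0≢0 → ⊥-elim (0≢0 refl)) , id ]′ nonzero))
      ... | no c₁≢0  | yes refl | _        = ⊥-elim (edge-pair-independent e₁≢e₃
        (vanishes₃-drop₁ (vanishes₃-swap₁₂ vanishes)) (inj₁ c₁≢0))
      ... | no c₁≢0  | no _     | yes refl = ⊥-elim (edge-pair-independent (e₁≢e₂ ∘ sym)
        (vanishes₃-drop₁ (vanishes₃-swap₁₃ vanishes)) (inj₂ c₁≢0))
      ... | no c₁≢0  | no c₂≢0  | no c₃≢0  =
        nonzero-vanishing⇒K3 atMostTwo e₁≢e₂ e₁≢e₃ e₂≢e₃ c₁≢0 c₂≢0 c₃≢0 vanishes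

      dependent⇒K3OrD2 : AtMostTwoParallel Γ → ∀ {i₁ i₂ i₃} → i₁ < i₂ → i₂ < i₃ →
        Dependent Γ (i₁ ∷ i₂ ∷ i₃ ∷ []) → K3OrD2 i₁ i₂ i₃
      dependent⇒K3OrD2 _ {i₂ = zero} () _ _
      dependent⇒K3OrD2 _ {i₂ = suc _} {zero} _ () _
      dependent⇒K3OrD2 _ {zero} {suc e} {suc f} _ e<f (_ ∷ _ ∷ _ ∷ [] , refl , nonzero , vanishes) =
        inj₂ (refl , e , f , refl , refl ,
              dependent-H₀-edges⇒D2 (<⇒≢ (s<s⁻¹ e<f)) (vanishing₃ vanishes) (any₃⇒⊎ nonzero))
      dependent⇒K3OrD2 atMostTwo {suc e₁} {suc e₂} {suc e₃} e₁<e₂ e₂<e₃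
                       (_ ∷ _ ∷ _ ∷ [] , refl , nonzero , vanishes) =
        inj₁ (e₁ , e₂ , e₃ , refl , refl , refl ,
              dependent-edges⇒K3 atMostTwo (<⇒≢ (s<s⁻¹ e₁<e₂)) (<⇒≢ (s<s⁻¹ (<-trans e₁<e₂ e₂<e₃)))
                (<⇒≢ (s<s⁻¹ e₂<e₃)) (vanishing₃ vanishes) (any₃⇒⊎ nonzero))

lemma5p2 : {ℓ n : ℕ} (Γ : GainGraph ℓ n) →
    NoLoops Γ → AtMostTwoParallel Γ → TwoCirclesUnbalanced Γ →
    (i₁ i₂ i₃ : Fin (suc n)) → i₁ < i₂ → i₂ < i₃ →
    Dependent Γ (i₁ ∷ i₂ ∷ i₃ ∷ []) ⇔
      ((∃[ e₁ ] ∃[ e₂ ] ∃[ e₃ ]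
          (i₁ ≡ suc e₁ × i₂ ≡ suc e₂ × i₃ ≡ suc e₃ × IsK3 Γ e₁ e₂ e₃))
       ⊎ (i₁ ≡ zero × ∃[ e₂ ] ∃[ e₃ ]
          (i₂ ≡ suc e₂ × i₃ ≡ suc e₃ × IsD2 Γ e₂ e₃)))
lemma5p2 Γ noLoops atMostTwo unbalanced _ _ _ i₁<i₂ i₂<i₃ =
  mk⇔ (dependent⇒K3OrD2 Γ noLoops unbalanced atMostTwo i₁<i₂ i₂<i₃) (K3OrD2⇒dependent Γ noLoops)
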